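{- Let $\mathcal L$ be a finite graded lattice (not necessarily atomic) and let $\mathcal P$ be a geometric lattice. If there exists a rank-preserving order embedding $f:\mathcal L\to\mathcal P$ whose restriction to $A(\mathcal L)$ is an injection into $A(\mathcal P)$, then $f(I)\in I(\mathcal P)$ for every $I\in I(\mathcal L)$.
   Context: A graded lattice is a lattice with least element $\hat0$ and greatest element $\hat1$ and a rank function $\mathrm{rank}$ with $\mathrm{rank}(\hat0)=0$, order-preserving, increasing by exactly $1$ along covering relations. An atom is an element covering $\hat0$; $A(\mathcal L)$ is the set of atoms. For a linear order $\omega$ on $A(\mathcal L)$, a nonempty set $D\subseteq A(\mathcal L)$ is bounded below if some atom $a$ is strictly smaller than every $d\in D$ in $\omega$ and $a\le\bigvee D$ in $\mathcal L$; a set of atoms is NBB with respect to $\omega$ if it contains no bounded below subset. $I(\mathcal L)$ is the family of all sets of atoms NBB with respect to at least one linear order on $A(\mathcal L)$; $I(\mathcal P)$ is defined the same way for the geometric lattice $\mathcal P$ (lattice of flats of a simple matroid). A rank-preserving order embedding is a map $f$ with $x\le y\iff f(x)\le f(y)$ and $\mathrm{rank}(f(x))=\mathrm{rank}(x)$. -}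

module Defs where

open import Level using (0ℓ)
open import Data.Nat as ℕ using (ℕ; suc) renaming (_≤_ to _≤ℕ_; _+_ to _+ℕ_)
open import Data.Fin using (Fin)
open import Data.Fin.Properties using (_≟_; any?)
open import Data.Fin.Subset using (Subset; _∈_; _⊆_)
open import Data.Fin.Subset.Properties using (_∈?_)
open import Data.List using (List; foldr; filter; allFin)
open import Data.Vec using (tabulate)
open import Data.Product using (Σ; ∃; ∃-syntax; _×_; _,_)
open import Data.Sum using (_⊎_)
open import Relation.Nullary using (¬_; does)
open import Relation.Nullary.Decidable using (_×-dec_)
open import Relation.Binary.PropositionalEquality using (_≡_; _≢_)
open import Relation.Binary.Lattice.Structures using (IsBoundedLattice)
open import Function.Definitions using (Injective)

record GradedLattice : Set₁ where
  field
    size   : ℕ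
    _≤_    : Fin size → Fin size → Set
    _∨_    : Fin size → Fin size → Fin size
    _∧_    : Fin size → Fin size → Fin size
    ⊤      : Fin size
    ⊥      : Fin size
    isBoundedLattice : IsBoundedLattice _≡_ _≤_ _∨_ _∧_ ⊤ ⊥
    rank   : Fin size → ℕ

  Carrier : Set
  Carrier = Fin size

  _<_ : Carrier → Carrier → Set
  x < y = x ≤ y × x ≢ y

  _⋖_ : Carrier → Carrier → Set
  x ⋖ y = x < y × (∀ z → ¬ (x < z × z < y))

  field
    rank-⊥    : rank ⊥ ≡ 0
    rank-mono : ∀ {x y} → x ≤ y → rank x ≤ℕ rank y
    rank-⋖    : ∀ {x y} → x ⋖ y → rank y ≡ suc (rank x)

  IsAtom : Carrier → Set
  IsAtom a = ⊥ ⋖ a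

  AtomSet : Subset size → Set
  AtomSet S = ∀ {x} → x ∈ S → IsAtom x

  ⋁ : Subset size → Carrier
  ⋁ S = foldr _∨_ ⊥ (filter (_∈? S) (allFin size))

  record AtomOrder : Set₁ where
    field
      _≺_     : Carrier → Carrier → Set
      irrefl  : ∀ {a} → IsAtom a → ¬ (a ≺ a)
      trans   : ∀ {a b c} → IsAtom a → IsAtom b → IsAtom c →
                a ≺ b → b ≺ c → a ≺ c
      total   : ∀ {a b} → IsAtom a → IsAtom b → a ≢ b → (a ≺ b) ⊎ (b ≺ a)

  BoundedBelow : AtomOrder → Subset size → Set
  BoundedBelow ω D =
    (∃[ d ] d ∈ D) ×
    (∃[ a ] IsAtom a × (∀ {d} → d ∈ D → AtomOrder._≺_ ω a d) × a ≤ ⋁ D)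

  NBB : AtomOrder → Subset size → Set
  NBB ω I = AtomSet I × (∀ D → D ⊆ I → ¬ BoundedBelow ω D)

  InI : Subset size → Set₁
  InI I = Σ AtomOrder λ ω → NBB ω I

record GeometricLattice : Set₁ where
  field
    lattice : GradedLattice
  open GradedLattice lattice
  field
    atomic      : ∀ x → ∃[ S ] AtomSet S × ⋁ S ≡ x
    semimodular : ∀ x y → rank (x ∨ y) +ℕ rank (x ∧ y) ≤ℕ rank x +ℕ rank y

module _ (L P : GradedLattice) where
  private
    module L = GradedLattice L
    module P = GradedLattice P

  record RankPreservingOrderEmbedding (f : L.Carrier → P.Carrier) : Set where
    field
      order-reflect  : ∀ {x y} → f x P.≤ f y → x L.≤ y
      order-preserve : ∀ {x y} → x L.≤ y → f x P.≤ f y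
      rank-preserve  : ∀ x → P.rank (f x) ≡ L.rank x

  AtomInjection : (L.Carrier → P.Carrier) → Set
  AtomInjection f =
    (∀ {a} → L.IsAtom a → P.IsAtom (f a)) ×
    (∀ {a b} → L.IsAtom a → L.IsAtom b → f a ≡ f b → a ≡ b)

  image : (L.Carrier → P.Carrier) → Subset L.size → Subset P.size
  image f S = tabulate λ j → does (any? λ i → (i ∈? S) ×-dec (f i ≟ j))

{-# OPTIONS --safe #-}
module Submission where

-- Put the atoms of f(I) first, ordered as their (unique) preimages are by ω, and the other
-- atoms of P after them in any order.  If D ⊆ f(I) were bounded below by an atom a, then a
-- precedes some f(j) with j ∈ I, so a = f(i) with i ∈ I, and i precedes every atom of
-- I ∩ f⁻¹(D).  Since f is monotone, f(i) ≤ ⋁ D ≤ f(⋁ (I ∩ f⁻¹(D))), and since f reflects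
-- the order, i ≤ ⋁ (I ∩ f⁻¹(D)): this subset of I would be bounded below in L.  Neither the
-- ranks nor the geometric structure of P play a role.

open import Defs
open import Data.Fin.Subset using (Subset)

open import Data.Fin using (Fin; toℕ)
open import Data.Fin.Properties using (toℕ-injective; _≟_; any?)
open import Data.Fin.Subset using (_∈_; _∉_; _⊆_; _∩_)
open import Data.Fin.Subset.Properties using (_∈?_; x∈p∩q⁺; p∩q⊆p; p∩q⊆q)
open import Data.List using (List; []; _∷_; foldr; filter; allFin)
import Data.List.Membership.Propositional as List
open import Data.List.Membership.Propositional.Properties using (∈-filter⁺; ∈-filter⁻; ∈-allFin)
open import Data.List.Relation.Unary.Any using (here; there)
open import Data.Nat using (_<_)
open import Data.Nat.Properties using (<-irrefl; <-trans; <-cmp)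
open import Data.Product using (∃; _×_; _,_; proj₂)
open import Data.Empty using (⊥-elim)
open import Data.Sum using (_⊎_; inj₁; inj₂)
open import Data.Vec using (tabulate)
open import Data.Vec.Properties using (lookup∘tabulate; []=⇒lookup; lookup⇒[]=)
open import Function using (_∘_)
open import Relation.Binary.Definitions using (tri<; tri≈; tri>)
open import Relation.Binary.Lattice.Structures using (IsBoundedLattice)
open import Relation.Binary.PropositionalEquality using (_≡_; _≢_; refl; sym; trans; cong)
open import Relation.Nullary using (¬_; yes; no; does)
open import Relation.Nullary.Decidable using (_×-dec_; dec-true)
open import Relation.Unary using (Pred; Decidable)

module _ {ℓ n} {Q : Pred (Fin n) ℓ} (Q? : Decidable Q) {x : Fin n} where

  ∈-tabulate⁻ : x ∈ tabulate (does ∘ Q?) → Q x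
  ∈-tabulate⁻ x∈ with Q? x | trans (sym (lookup∘tabulate (does ∘ Q?) x)) ([]=⇒lookup x∈)
  ... | yes q | _  = q
  ... | no _  | ()

  ∈-tabulate⁺ : Q x → x ∈ tabulate (does ∘ Q?)
  ∈-tabulate⁺ q = lookup⇒[]= x _ (trans (lookup∘tabulate (does ∘ Q?) x) (dec-true (Q? x) q))

module BigJoin (L : GradedLattice) where
  open GradedLattice L
  open IsBoundedLattice isBoundedLattice using (minimum; x≤x∨y; y≤x∨y; ∨-least) renaming (trans to ≤-trans)

  foldr-∨-least : ∀ (xs : List Carrier) u → (∀ {x} → x List.∈ xs → x ≤ u) → foldr _∨_ ⊥ xs ≤ u
  foldr-∨-least []       u xs≤u = minimum u
  foldr-∨-least (x ∷ xs) u xs≤u = ∨-least (xs≤u (here refl)) (foldr-∨-least xs u (xs≤u ∘ there))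

  foldr-∨-upper : ∀ (xs : List Carrier) {x} → x List.∈ xs → x ≤ foldr _∨_ ⊥ xs
  foldr-∨-upper (y ∷ xs) (here refl) = x≤x∨y y _
  foldr-∨-upper (y ∷ xs) (there x∈)  = ≤-trans (foldr-∨-upper xs x∈) (y≤x∨y y _)

  ⋁-least : ∀ S u → (∀ {x} → x ∈ S → x ≤ u) → ⋁ S ≤ u
  ⋁-least S u S≤u = foldr-∨-least (filter (_∈? S) (allFin size)) u
    (S≤u ∘ proj₂ ∘ ∈-filter⁻ (_∈? S) {xs = allFin size})

  ⋁-upper : ∀ S {x} → x ∈ S → x ≤ ⋁ S
  ⋁-upper S {x} x∈S = foldr-∨-upper (filter (_∈? S) (allFin size)) (∈-filter⁺ (_∈? S) (∈-allFin x) x∈S)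

module _ (L P : GradedLattice) (f : GradedLattice.Carrier L → GradedLattice.Carrier P) where
  private
    module L = GradedLattice L
    module P = GradedLattice P

  ∈-image⁻ : ∀ {S y} → y ∈ image L P f S → ∃ λ x → x ∈ S × f x ≡ y
  ∈-image⁻ {S} = ∈-tabulate⁻ (λ y → any? λ x → (x ∈? S) ×-dec (f x ≟ y))

  ∈-image⁺ : ∀ {S x} → x ∈ S → f x ∈ image L P f S
  ∈-image⁺ {S} {x} x∈S = ∈-tabulate⁺ (λ y → any? λ x → (x ∈? S) ×-dec (f x ≟ y)) (x , x∈S , refl)

  preimage : Subset P.size → Subset L.size
  preimage D = tabulate λ x → does (f x ∈? D)

  ∈-preimage⁻ : ∀ {D x} → x ∈ preimage D → f x ∈ D
  ∈-preimage⁻ {D} = ∈-tabulate⁻ (λ x → f x ∈? D)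

  ∈-preimage⁺ : ∀ {D x} → f x ∈ D → x ∈ preimage D
  ∈-preimage⁺ {D} = ∈-tabulate⁺ (λ x → f x ∈? D)

  image-AtomSet : (∀ {a} → L.IsAtom a → P.IsAtom (f a)) →
                  ∀ {S} → L.AtomSet S → P.AtomSet (image L P f S)
  image-AtomSet f-atom S-atoms y∈ with ∈-image⁻ y∈
  ... | x , x∈S , refl = f-atom (S-atoms x∈S)

  module _ (f-mono : ∀ {x y} → x L.≤ y → f x P.≤ f y) where

    ⋁-≤-image-⋁-preimage : ∀ {T} S → S ⊆ image L P f T → P.⋁ S P.≤ f (L.⋁ (T ∩ preimage S))
    ⋁-≤-image-⋁-preimage {T} S S⊆fT = BigJoin.⋁-least P S _ below
      where
      below : ∀ {y} → y ∈ S → y P.≤ f (L.⋁ (T ∩ preimage S))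
      below y∈S with ∈-image⁻ (S⊆fT y∈S)
      ... | x , x∈T , refl = f-mono (BigJoin.⋁-upper L _ (x∈p∩q⁺ (x∈T , ∈-preimage⁺ y∈S)))

module ExtendedOrder
  (L P : GradedLattice) (f : GradedLattice.Carrier L → GradedLattice.Carrier P)
  (I : Subset (GradedLattice.size L)) (ω : GradedLattice.AtomOrder L)
  (I-atoms : GradedLattice.AtomSet L I)
  (f-injective : ∀ {i j} → i ∈ I → j ∈ I → f i ≡ f j → i ≡ j)
  where
  private
    module P = GradedLattice P
    module ω = GradedLattice.AtomOrder ω
  open ω using (_≺_)

  fI : Subset P.size
  fI = image L P f I

  data _≺′_ (x y : P.Carrier) : Set where
    image≺image : ∀ {i j} → i ∈ I → j ∈ I → f i ≡ x → f j ≡ y → i ≺ j → x ≺′ y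
    image≺other : x ∈ fI → y ∉ fI → x ≺′ y
    other≺other : x ∉ fI → y ∉ fI → toℕ x < toℕ y → x ≺′ y

  ≺′-irrefl : ∀ {x} → ¬ (x ≺′ x)
  ≺′-irrefl (image≺image i∈ j∈ refl fj≡fi i≺j) with refl ← f-injective j∈ i∈ fj≡fi =
    ω.irrefl (I-atoms i∈) i≺j
  ≺′-irrefl (image≺other x∈ x∉)   = x∉ x∈
  ≺′-irrefl (other≺other _ _ x<x) = <-irrefl refl x<x

  ≺′-trans : ∀ {x y z} → x ≺′ y → y ≺′ z → x ≺′ z
  ≺′-trans (image≺image i∈ j∈ refl refl i≺j) (image≺image j′∈ k∈ fj′≡fj refl j≺k)
    with refl ← f-injective j′∈ j∈ fj′≡fj =
    image≺image i∈ k∈ refl refl (ω.trans (I-atoms i∈) (I-atoms j∈) (I-atoms k∈) i≺j j≺k)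
  ≺′-trans (image≺image i∈ _ refl _ _)   (image≺other _ z∉)       = image≺other (∈-image⁺ L P f i∈) z∉
  ≺′-trans (image≺image _ j∈ _ refl _)   (other≺other y∉ _ _)     = ⊥-elim (y∉ (∈-image⁺ L P f j∈))
  ≺′-trans (image≺other _ y∉)            (image≺image j∈ _ refl _ _) = ⊥-elim (y∉ (∈-image⁺ L P f j∈))
  ≺′-trans (image≺other _ y∉)            (image≺other y∈ _)       = ⊥-elim (y∉ y∈)
  ≺′-trans (image≺other x∈ _)            (other≺other _ z∉ _)     = image≺other x∈ z∉
  ≺′-trans (other≺other _ y∉ _)          (image≺image j∈ _ refl _ _) = ⊥-elim (y∉ (∈-image⁺ L P f j∈))
  ≺′-trans (other≺other _ y∉ _)          (image≺other y∈ _)       = ⊥-elim (y∉ y∈)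
  ≺′-trans (other≺other x∉ _ x<y)        (other≺other _ z∉ y<z)   = other≺other x∉ z∉ (<-trans x<y y<z)

  ≺′-total : ∀ {x y} → x ≢ y → x ≺′ y ⊎ y ≺′ x
  ≺′-total {x} {y} x≢y with x ∈? fI | y ∈? fI
  ... | yes x∈ | yes y∈ with ∈-image⁻ L P f x∈ | ∈-image⁻ L P f y∈
  ...   | i , i∈ , refl | j , j∈ , refl with ω.total (I-atoms i∈) (I-atoms j∈) (x≢y ∘ cong f)
  ...     | inj₁ i≺j = inj₁ (image≺image i∈ j∈ refl refl i≺j)
  ...     | inj₂ j≺i = inj₂ (image≺image j∈ i∈ refl refl j≺i)
  ≺′-total {x} {y} x≢y | yes x∈ | no y∉ = inj₁ (image≺other x∈ y∉)
  ≺′-total {x} {y} x≢y | no x∉  | yes y∈ = inj₂ (image≺other y∈ x∉)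
  ≺′-total {x} {y} x≢y | no x∉  | no y∉ with <-cmp (toℕ x) (toℕ y)
  ... | tri< x<y _ _ = inj₁ (other≺other x∉ y∉ x<y)
  ... | tri≈ _ x≡y _ = ⊥-elim (x≢y (toℕ-injective x≡y))
  ... | tri> _ _ y<x = inj₂ (other≺other y∉ x∉ y<x)

  extendedOrder : P.AtomOrder
  extendedOrder = record
    { _≺_    = _≺′_
    ; irrefl = λ _ → ≺′-irrefl
    ; trans  = λ _ _ _ → ≺′-trans
    ; total  = λ _ _ → ≺′-total
    }

  ≺′-image-downward : ∀ {x y} → x ≺′ y → y ∈ fI → x ∈ fI
  ≺′-image-downward (image≺image i∈ _ refl _ _) _  = ∈-image⁺ L P f i∈
  ≺′-image-downward (image≺other x∈ _)          _  = x∈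
  ≺′-image-downward (other≺other _ y∉ _)        y∈ = ⊥-elim (y∉ y∈)

  ≺′-reflect : ∀ {i j} → i ∈ I → j ∈ I → f i ≺′ f j → i ≺ j
  ≺′-reflect i∈ j∈ (image≺image i′∈ j′∈ fi′≡fi fj′≡fj i′≺j′)
    with refl ← f-injective i′∈ i∈ fi′≡fi | refl ← f-injective j′∈ j∈ fj′≡fj = i′≺j′
  ≺′-reflect _ j∈ (image≺other _ fj∉)   = ⊥-elim (fj∉ (∈-image⁺ L P f j∈))
  ≺′-reflect _ j∈ (other≺other _ fj∉ _) = ⊥-elim (fj∉ (∈-image⁺ L P f j∈))

module _
  (L P : GradedLattice) (f : GradedLattice.Carrier L → GradedLattice.Carrier P)
  (f-mono    : ∀ {x y} → GradedLattice._≤_ L x y → GradedLattice._≤_ P (f x) (f y))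
  (f-reflect : ∀ {x y} → GradedLattice._≤_ P (f x) (f y) → GradedLattice._≤_ L x y)
  (I : Subset (GradedLattice.size L)) (ω : GradedLattice.AtomOrder L)
  (I-atoms : GradedLattice.AtomSet L I)
  (f-injective : ∀ {i j} → i ∈ I → j ∈ I → f i ≡ f j → i ≡ j)
  where
  private
    module L = GradedLattice L
    module P = GradedLattice P
  open ExtendedOrder L P f I ω I-atoms f-injective

  boundedBelow-preimage : ∀ {D} → D ⊆ fI → P.BoundedBelow extendedOrder D →
                          L.BoundedBelow ω (I ∩ preimage L P f D)
  boundedBelow-preimage {D} D⊆fI ((d , d∈D) , (a , _ , a≺D , a≤⋁D))
    with ∈-image⁻ L P f (D⊆fI d∈D)
  ... | j , j∈I , refl with ∈-image⁻ L P f (≺′-image-downward (a≺D d∈D) (D⊆fI d∈D))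
  ... | i , i∈I , refl =
    (j , x∈p∩q⁺ (j∈I , ∈-preimage⁺ L P f d∈D)) ,
    (i , I-atoms i∈I , i≺E , f-reflect fi≤f⋁E)
    where
    i≺E : ∀ {k} → k ∈ I ∩ preimage L P f D → L.AtomOrder._≺_ ω i k
    i≺E k∈ = ≺′-reflect i∈I (p∩q⊆p _ _ k∈) (a≺D (∈-preimage⁻ L P f (p∩q⊆q _ _ k∈)))

    fi≤f⋁E : f i P.≤ f (L.⋁ (I ∩ preimage L P f D))
    fi≤f⋁E = IsBoundedLattice.trans P.isBoundedLattice a≤⋁D
      (⋁-≤-image-⋁-preimage L P f f-mono D D⊆fI)

  image-noBoundedBelow : (∀ D → D ⊆ I → ¬ L.BoundedBelow ω D) →
                         ∀ D → D ⊆ fI → ¬ P.BoundedBelow extendedOrder D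
  image-noBoundedBelow I-nbb D D⊆fI D-bb =
    I-nbb _ (p∩q⊆p _ _) (boundedBelow-preimage D⊆fI D-bb)

corollary3p6 : (L : GradedLattice) (P : GeometricLattice)
    (f : GradedLattice.Carrier L → GradedLattice.Carrier (GeometricLattice.lattice P)) →
    RankPreservingOrderEmbedding L (GeometricLattice.lattice P) f →
    AtomInjection L (GeometricLattice.lattice P) f →
    (I : Subset (GradedLattice.size L)) → GradedLattice.InI L I →
    GradedLattice.InI (GeometricLattice.lattice P) (image L (GeometricLattice.lattice P) f I)
corollary3p6 L P f emb (f-atom , f-atom-injective) I (ω , I-atoms , I-nbb) =
  extendedOrder , image-AtomSet L P′ f f-atom I-atoms ,
  image-noBoundedBelow L P′ f order-preserve order-reflect I ω I-atoms f-injective I-nbb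
  where
  P′ = GeometricLattice.lattice P
  open RankPreservingOrderEmbedding emb using (order-preserve; order-reflect)

  f-injective : ∀ {i j} → i ∈ I → j ∈ I → f i ≡ f j → i ≡ j
  f-injective i∈ j∈ = f-atom-injective (I-atoms i∈) (I-atoms j∈)

  open ExtendedOrder L P′ f I ω I-atoms f-injective using (extendedOrder)
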